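{- Let $D$ be a cut-like ruleset of a language $S$, let $f:\mathbb N\to F_S$ be any map into the set $F_S$ of formulas of $S$, and let $X$ be a set. Define $X_0=X$ and, for $n\in\mathbb N$, $X_{n+1}=X_n\cup\{\neg f(n)\}$ if $X_n\vdash_D\neg f(n)$, and $X_{n+1}=X_n\cup\{f(n)\}$ otherwise; let $X^f=\bigcup_{n\in\mathbb N}X_n$. If $X$ is $D$-consistent, then $X^f$ is $D$-consistent.
   Context: A language $S$: integer-valued arity $\#$, $\equiv\in\operatorname{dom}\#$ with $\#(\equiv)=-2$, $\downarrow\notin\operatorname{dom}\#$; formulas are built from atomic formulas by $\downarrow\varphi\psi$ (NOR) and existential quantification $v\varphi$ over literals $v$; $\neg\varphi:=\downarrow\varphi\varphi$. A sequent is $(\Gamma,\varphi)$ with $\Gamma$ a finite set of formulas and $\varphi$ a formula; a rule is any map from sets of sequents to sets of sequents; a ruleset is a set of rules. For a ruleset $D$, $O_D(\Sigma)=\bigcup_{R\in D}R(\Sigma)$ and $O_D^n$ is its $n$-th iterate. $X\vdash_D\varphi$ iff there are $n$ and finite $\Gamma\subseteq X$ with $(\Gamma,\varphi)\in O^n_D(\emptyset)$. $X$ is $D$-consistent if there is no formula $\psi$ with $X\vdash_D\psi$ and $X\vdash_D\neg\psi$, and $D$-inconsistent otherwise. $D$ is cut-like if for all sets $X$ and formulas $\varphi$, $X\cup\{\varphi\}$ $D$-inconsistent implies $X\vdash_D\neg\varphi$. -}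

module Defs where

open import Data.Nat using (ℕ; zero; suc)
open import Data.Integer using (ℤ; +_; -[1+_])
open import Data.Vec using (Vec)
open import Data.List using (List)
open import Data.List.Relation.Unary.All using (All)
open import Data.Product using (Σ; ∃; _×_; _,_)
open import Data.Sum using (_⊎_)
open import Relation.Nullary using (¬_)
open import Relation.Binary.PropositionalEquality using (_≡_)

-- A language S: a type of symbols (dom #) with an integer-valued arity #,
-- containing the equality symbol with arity -2.  The NOR connective is not a
-- symbol (it is a separate formula constructor), so ↓ ∉ dom # holds by design.
record Language : Set₁ where
  field
    Sym    : Set
    arity  : Sym → ℤ
    eqSym  : Sym
    eqArity : arity eqSym ≡ -[1+ 1 ]

module _ (S : Language) where
  open Language S

  data Term : Set where
    app : (s : Sym) (n : ℕ) → arity s ≡ + n → Vec Term n → Term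

  data Formula : Set where
    atom : (r : Sym) (k : ℕ) → arity r ≡ -[1+ k ] → Vec Term (suc k) → Formula
    nor  : Formula → Formula → Formula
    ex   : (v : Sym) → arity v ≡ + 0 → Formula → Formula

  neg : Formula → Formula
  neg φ = nor φ φ

  FSet : Set₁
  FSet = Formula → Set

  -- a sequent (Γ , φ), Γ a finite set represented by a list
  record Sequent : Set where
    constructor seq
    field
      ctx  : List Formula
      conc : Formula

  SSet : Set₁
  SSet = Sequent → Set

  Rule : Set₁
  Rule = SSet → SSet

  record Ruleset : Set₁ where
    field
      Index : Set
      rule  : Index → Rule

  module _ (D : Ruleset) where
    open Ruleset D

    O : SSet → SSet
    O Σs s = Σ Index (λ i → rule i Σs s)

    ∅ : SSet
    ∅ _ = Data.Empty.⊥
      where import Data.Empty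

    Oⁿ∅ : ℕ → SSet
    Oⁿ∅ zero = ∅
    Oⁿ∅ (suc n) = O (Oⁿ∅ n)

    _⊢_ : FSet → Formula → Set
    X ⊢ φ = Σ ℕ λ n → Σ (List Formula) λ Γ → All X Γ × Oⁿ∅ n (seq Γ φ)

    Consistent : FSet → Set
    Consistent X = ¬ (Σ Formula λ ψ → (X ⊢ ψ) × (X ⊢ neg ψ))

    _∪｛_｝ : FSet → Formula → FSet
    (X ∪｛ φ ｝) χ = X χ ⊎ (χ ≡ φ)

    CutLike : Set₁
    CutLike = (X : FSet) (φ : Formula) → ¬ Consistent (X ∪｛ φ ｝) → X ⊢ neg φ

    chain : (ℕ → Formula) → FSet → ℕ → FSet
    chain f X zero = X
    chain f X (suc n) χ =
      chain f X n χ
      ⊎ ((chain f X n ⊢ neg (f n)) × (χ ≡ neg (f n)))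
      ⊎ ((¬ (chain f X n ⊢ neg (f n))) × (χ ≡ f n))

    Xᶠ : (ℕ → Formula) → FSet → FSet
    Xᶠ f X χ = Σ ℕ λ n → chain f X n χ

-- Each stage X_{n+1} is consistent: if X_n ⊢ ¬ f n, adding ¬ f n is safe, since an
-- inconsistency would give X_n ⊢ ¬¬ f n by cut-likeness; otherwise adding f n is safe,
-- since an inconsistency would give X_n ⊢ ¬ f n.  A derivation uses only finitely many
-- hypotheses, which all lie in a single stage of the increasing chain, so an
-- inconsistency of X^f would already be one of some X_n.
module Submission where

open import Defs
open import Data.Nat using (ℕ; zero; suc; _≤_; _≤′_; ≤′-refl; ≤′-step; _⊔_)
open import Data.Nat.Properties using (≤⇒≤′; m≤m⊔n; m≤n⊔m)
open import Data.List.Relation.Unary.All as All using (All; []; _∷_)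
open import Data.Product using (Σ; _,_)
open import Data.Sum using (inj₁; inj₂)
open import Data.Empty using (⊥-elim)
open import Relation.Nullary using (¬_; yes; no; ¬¬-excluded-middle)
open import Relation.Unary using (_⊆_; ⋃)

module _ (S : Language) (D : Ruleset S) where

  private
    _⊢ₛ_ : FSet S → Formula S → Set
    _⊢ₛ_ = _⊢_ S D

    _∪ₛ_ : FSet S → Formula S → FSet S
    _∪ₛ_ = _∪｛_｝ S D

  ⊢-mono : {Y Z : FSet S} → Y ⊆ Z → ∀ {φ} → Y ⊢ₛ φ → Z ⊢ₛ φ
  ⊢-mono Y⊆Z (n , Γ , Γ⊆Y , d) = n , Γ , All.map Y⊆Z Γ⊆Y , d

  Consistent-antimono : {Y Z : FSet S} → Y ⊆ Z → Consistent S D Z → Consistent S D Y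
  Consistent-antimono Y⊆Z cZ (ψ , p , q) = cZ (ψ , ⊢-mono Y⊆Z p , ⊢-mono Y⊆Z q)

  module _ (cutLike : CutLike S D) where

    Consistent-∪-refutable : ∀ {Y φ} → Consistent S D Y → Y ⊢ₛ neg S φ →
                             Consistent S D (Y ∪ₛ neg S φ)
    Consistent-∪-refutable cY Y⊢¬φ inc = cY (neg S _ , Y⊢¬φ , cutLike _ _ (λ c → c inc))

    Consistent-∪-irrefutable : ∀ {Y φ} → ¬ (Y ⊢ₛ neg S φ) → Consistent S D (Y ∪ₛ φ)
    Consistent-∪-irrefutable Y⊬¬φ inc = Y⊬¬φ (cutLike _ _ (λ c → c inc))

  module _ (Y : ℕ → FSet S) (Y-step : ∀ n → Y n ⊆ Y (suc n)) where

    chain-mono : ∀ {m n} → m ≤ n → Y m ⊆ Y n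
    chain-mono m≤n = go (≤⇒≤′ m≤n)
      where
      go : ∀ {m n} → m ≤′ n → Y m ⊆ Y n
      go ≤′-refl         = λ y → y
      go (≤′-step m≤′n) = λ y → Y-step _ (go m≤′n y)

    All-⋃-stage : ∀ {Γ} → All (⋃ ℕ Y) Γ → Σ ℕ λ m → All (Y m) Γ
    All-⋃-stage []                = 0 , []
    All-⋃-stage ((k , y) ∷ Γ⊆⋃) with All-⋃-stage Γ⊆⋃
    ... | m , Γ⊆Yₘ = k ⊔ m , chain-mono (m≤m⊔n k m) y ∷ All.map (chain-mono (m≤n⊔m k m)) Γ⊆Yₘ

    ⊢-⋃-stage : ∀ {φ} → ⋃ ℕ Y ⊢ₛ φ → Σ ℕ λ m → Y m ⊢ₛ φ
    ⊢-⋃-stage (n , Γ , Γ⊆⋃ , d) with All-⋃-stage Γ⊆⋃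
    ... | m , Γ⊆Yₘ = m , n , Γ , Γ⊆Yₘ , d

    Consistent-⋃ : (∀ n → Consistent S D (Y n)) → Consistent S D (⋃ ℕ Y)
    Consistent-⋃ cY (ψ , p , q) with ⊢-⋃-stage p | ⊢-⋃-stage q
    ... | m₁ , p₁ | m₂ , q₂ =
      cY (m₁ ⊔ m₂) (ψ , ⊢-mono (chain-mono (m≤m⊔n m₁ m₂)) p₁
                      , ⊢-mono (chain-mono (m≤n⊔m m₁ m₂)) q₂)

  module _ (f : ℕ → Formula S) (X : FSet S) where

    private
      Xₙ : ℕ → FSet S
      Xₙ = chain S D f X

    chain-step : ∀ n → Xₙ n ⊆ Xₙ (suc n)
    chain-step n = inj₁

    chain-step-refutable : ∀ n → Xₙ n ⊢ₛ neg S (f n) → Xₙ (suc n) ⊆ Xₙ n ∪ₛ neg S (f n)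
    chain-step-refutable n _   (inj₁ x)                 = inj₁ x
    chain-step-refutable n _   (inj₂ (inj₁ (_ , eq)))   = inj₂ eq
    chain-step-refutable n ⊢¬f (inj₂ (inj₂ (⊬¬f , _))) = ⊥-elim (⊬¬f ⊢¬f)

    chain-step-irrefutable : ∀ n → ¬ (Xₙ n ⊢ₛ neg S (f n)) → Xₙ (suc n) ⊆ Xₙ n ∪ₛ f n
    chain-step-irrefutable n _   (inj₁ x)                 = inj₁ x
    chain-step-irrefutable n ⊬¬f (inj₂ (inj₁ (⊢¬f , _))) = ⊥-elim (⊬¬f ⊢¬f)
    chain-step-irrefutable n _   (inj₂ (inj₂ (_ , eq)))   = inj₂ eq

    -- Consistency is a negation, so the case split on X_n ⊢ ¬ f n is available constructively.
    Consistent-chain-suc : CutLike S D → ∀ n → Consistent S D (Xₙ n) → Consistent S D (Xₙ (suc n))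
    Consistent-chain-suc cutLike n cXₙ inc = ¬¬-excluded-middle λ
      { (yes ⊢¬f) → Consistent-antimono (chain-step-refutable n ⊢¬f)
                       (Consistent-∪-refutable cutLike cXₙ ⊢¬f) inc
      ; (no ⊬¬f)  → Consistent-antimono (chain-step-irrefutable n ⊬¬f)
                       (Consistent-∪-irrefutable cutLike ⊬¬f) inc
      }

    Consistent-chain : CutLike S D → Consistent S D X → ∀ n → Consistent S D (Xₙ n)
    Consistent-chain cutLike cX zero    = cX
    Consistent-chain cutLike cX (suc n) = Consistent-chain-suc cutLike n (Consistent-chain cutLike cX n)

mainTheorem9 : (S : Language) (D : Ruleset S) → CutLike S D →
    (f : ℕ → Formula S) (X : FSet S) →
    Consistent S D X → Consistent S D (Xᶠ S D f X)
mainTheorem9 S D cutLike f X cX =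
  Consistent-⋃ S D (chain S D f X) (chain-step S D f X) (Consistent-chain S D f X cutLike cX)
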